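{- For every integer $n\ge 5$, the Kneser graph $K(n,2)$ is $P_6$-induced-saturated.
   Context: The Kneser graph $K(n,r)$ has as vertices the $r$-element subsets of $\{1,2,\ldots,n\}$, two vertices being adjacent if and only if the corresponding subsets are disjoint. $P_k$ denotes the path on $k$ vertices. For a graph $H$, a graph $G$ is $H$-induced-saturated if $G$ does not contain an induced subgraph isomorphic to $H$, but for every edge $e$ of $G$ the graph $G-e$ contains an induced copy of $H$, and for every non-edge $e$ of $G$ the graph $G+e$ contains an induced copy of $H$. -}

module Defs where

open import Level using (0ℓ)
open import Data.Nat using (ℕ; suc)
open import Data.Fin using (Fin; toℕ)
open import Data.Fin.Subset using (Subset; ∣_∣; _∩_; Empty)
open import Data.Product using (Σ; _×_; _,_)
open import Data.Sum using (_⊎_)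
open import Relation.Nullary using (¬_)
open import Relation.Binary.PropositionalEquality using (_≡_; _≢_)
open import Function.Definitions using (Injective)
open import Function.Bundles using (_⇔_)

-- A (simple) graph is given by a vertex type V and an adjacency relation on V.
-- (Kneser graphs below are symmetric and irreflexive.)

KVertex : ℕ → ℕ → Set
KVertex n r = Σ (Subset n) (λ s → ∣ s ∣ ≡ r)

KAdj : (n r : ℕ) → KVertex n r → KVertex n r → Set
KAdj n r (s , _) (t , _) = Empty (s ∩ t)

PathAdj : (k : ℕ) → Fin k → Fin k → Set
PathAdj k i j = (toℕ j ≡ suc (toℕ i)) ⊎ (toℕ i ≡ suc (toℕ j))

InducedPath : (V : Set) → (V → V → Set) → ℕ → Set
InducedPath V E k =
  Σ (Fin k → V) λ f → Injective _≡_ _≡_ f × (∀ i j → E (f i) (f j) ⇔ PathAdj k i j)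

SamePair : {V : Set} → V → V → V → V → Set
SamePair u v x y = (x ≡ u × y ≡ v) ⊎ (x ≡ v × y ≡ u)

removeEdge : {V : Set} → (V → V → Set) → V → V → (V → V → Set)
removeEdge E u v x y = E x y × ¬ SamePair u v x y

addEdge : {V : Set} → (V → V → Set) → V → V → (V → V → Set)
addEdge E u v x y = E x y ⊎ SamePair u v x y

InducedSaturated : (V : Set) → (V → V → Set) → ℕ → Set
InducedSaturated V E k =
  ¬ InducedPath V E k
  × (∀ u v → E u v → InducedPath V (removeEdge E u v) k)
  × (∀ u v → u ≢ v → ¬ E u v → InducedPath V (addEdge E u v) k)

-- No induced P₆: if v₀ … v₅ were an induced path, v₀ and v₁ would each meet v₃, v₄ and v₅,
-- while v₄ is disjoint from v₃ and v₅; so each of v₀, v₁ contains a point of v₃ ∩ v₅.  These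
-- points differ because v₀ ∩ v₁ = ∅, and two distinct common points force v₃ = v₅.
-- Saturation: an edge of K(n,2), or a non-edge with distinct ends, involves at most four
-- points.  An injection Fin 5 → Fin n through them induces an embedding of K(5,2) as an
-- induced subgraph of K(n,2) that carries a fixed pair of K(5,2) to the given one, and in
-- K(5,2) the required induced P₆ is found by evaluation.
module Submission where

open import Defs
open import Data.Bool using () renaming (_≟_ to _≟ᵇ_)
open import Data.Empty using (⊥; ⊥-elim)
open import Data.Fin using (Fin; zero; suc; toℕ; _≟_; #_)
open import Data.Fin.Properties using (all?; any?; ¬∀⟶∃¬; injective⇒≤)
open import Data.Fin.Subset using (Subset; _∈_; _∉_; _⊆_; _∪_; _∩_; _-_; ⁅_⁆; ∣_∣)
  renaming (⊥ to ∅)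
open import Data.Fin.Subset.Properties
  using ( _∈?_; nonempty?; ⊆-reflexive; ⊆-antisym; p⊆q⇒∣p∣≤∣q∣; ∣⊥∣≡0; ∣⁅x⁆∣≡1
        ; x∈⁅x⁆; x∈⁅y⁆⇒x≡y; x∉⁅y⁆⇒x≢y; x∈p∪q⁺; x∈p∪q⁻; x∈p∩q⁺; x∈p∩q⁻
        ; ∪-identityˡ; ∪-identityʳ; x∈p∧x≢y⇒x∈p-y; x∈p⇒∣p-x∣<∣p∣)
open import Data.Nat using (ℕ; suc; _≤_; _<_; z≤n; s≤s)
open import Data.Nat.Properties using (≤-trans; n≤1+n; ≤-reflexive; <⇒≱; ≡-irrelevant)
  renaming (_≟_ to _≟ℕ_)
open import Data.Product using (Σ; ∃; ∃₂; _×_; _,_; proj₁; proj₂)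
import Data.Product as Product
open import Data.Product.Function.NonDependent.Propositional using (_×-⇔_)
open import Data.Sum using (_⊎_; inj₁; inj₂)
import Data.Sum as Sum
open import Data.Sum.Function.Propositional using (_⊎-⇔_)
open import Data.Vec.Functional using ([]; _∷_)
open import Data.Vec.Properties using (≡-dec)
open import Function using (_∘_)
open import Function.Bundles using (_⇔_; mk⇔; Equivalence)
open import Function.Construct.Composition using (_⇔-∘_)
open import Function.Construct.Symmetry using (⇔-sym)
open import Function.Definitions using (Injective)
open import Function.Related.TypeIsomorphisms using (¬-cong-⇔)
open import Relation.Binary.Definitions using (DecidableEquality)
  renaming (Decidable to Decidable₂)
open import Relation.Binary.PropositionalEquality
  using (_≡_; _≢_; refl; sym; trans; cong; subst; ≢-sym)
open import Relation.Nullary using (¬_; Dec; yes; no; ¬?; contradiction)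
open import Relation.Nullary.Decidable
  using ( _×-dec_; _⊎-dec_; _→-dec_; map′; decidable-stable; from-yes
        ; True; False; toWitness; toWitnessFalse)

private variable
  k n r : ℕ
  x y z e : Fin n
  p : Subset n
  V W : Set
  E : V → V → Set
  F : W → W → Set

∣q∣<∣p∣⇒∃∈p∉q : {q : Subset n} → ∣ q ∣ < ∣ p ∣ → ∃ λ x → x ∈ p × x ∉ q
∣q∣<∣p∣⇒∃∈p∉q {n} {p} {q} ∣q∣<∣p∣
  with ¬∀⟶∃¬ n (λ x → x ∈ p → x ∈ q) (λ x → x ∈? p →-dec x ∈? q)
         (λ p⊆q → <⇒≱ ∣q∣<∣p∣ (p⊆q⇒∣p∣≤∣q∣ (p⊆q _)))
... | x , x∈p↛x∈q with x ∈? p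
...   | yes x∈p = x , x∈p , λ x∈q → x∈p↛x∈q (λ _ → x∈q)
...   | no  x∉p = ⊥-elim (x∈p↛x∈q (λ x∈p → contradiction x∈p x∉p))

1<∣p∣⇒distinct-members : 1 < ∣ p ∣ → ∃₂ λ x y → x ≢ y × x ∈ p × y ∈ p
1<∣p∣⇒distinct-members {n} {p} 1<∣p∣
  with ∣q∣<∣p∣⇒∃∈p∉q {q = ∅} (subst (_< ∣ p ∣) (sym (∣⊥∣≡0 n)) (≤-trans (s≤s z≤n) 1<∣p∣))
... | x , x∈p , _ with ∣q∣<∣p∣⇒∃∈p∉q {q = ⁅ x ⁆} (subst (_< ∣ p ∣) (sym (∣⁅x⁆∣≡1 x)) 1<∣p∣)
...   | y , y∈p , y∉⁅x⁆ = x , y , ≢-sym (x∉⁅y⁆⇒x≢y y∉⁅x⁆) , x∈p , y∈p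

-- Removing x, y and then z from p strictly decreases the size three times.
∣p∣≤2⇒z≡x⊎z≡y : ∣ p ∣ ≤ 2 → x ≢ y → x ∈ p → y ∈ p → z ∈ p → z ≡ x ⊎ z ≡ y
∣p∣≤2⇒z≡x⊎z≡y {p = p} {x} {y} {z} ∣p∣≤2 x≢y x∈p y∈p z∈p with z ≟ x | z ≟ y
... | yes z≡x | _       = inj₁ z≡x
... | no _    | yes z≡y = inj₂ z≡y
... | no z≢x  | no z≢y  = contradiction (≤-trans 3≤∣p∣ ∣p∣≤2) λ { (s≤s (s≤s ())) }
  where
  1≤∣p-x-y∣ : 1 ≤ ∣ p - x - y ∣
  1≤∣p-x-y∣ = ≤-trans (s≤s z≤n)
    (x∈p⇒∣p-x∣<∣p∣ (x∈p∧x≢y⇒x∈p-y (x∈p∧x≢y⇒x∈p-y z∈p z≢x) z≢y))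
  2≤∣p-x∣ : 2 ≤ ∣ p - x ∣
  2≤∣p-x∣ = ≤-trans (s≤s 1≤∣p-x-y∣) (x∈p⇒∣p-x∣<∣p∣ (x∈p∧x≢y⇒x∈p-y y∈p (≢-sym x≢y)))
  3≤∣p∣ : 3 ≤ ∣ p ∣
  3≤∣p∣ = ≤-trans (s≤s 2≤∣p-x∣) (x∈p⇒∣p-x∣<∣p∣ x∈p)

∣⁅x⁆∪⁅y⁆∣≡2 : x ≢ y → ∣ ⁅ x ⁆ ∪ ⁅ y ⁆ ∣ ≡ 2
∣⁅x⁆∪⁅y⁆∣≡2 {x = zero}  {zero}  x≢y = contradiction refl x≢y
∣⁅x⁆∪⁅y⁆∣≡2 {x = zero}  {suc y} _   = cong suc (trans (cong ∣_∣ (∪-identityˡ ⁅ y ⁆)) (∣⁅x⁆∣≡1 y))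
∣⁅x⁆∪⁅y⁆∣≡2 {x = suc x} {zero}  _   = cong suc (trans (cong ∣_∣ (∪-identityʳ ⁅ x ⁆)) (∣⁅x⁆∣≡1 x))
∣⁅x⁆∪⁅y⁆∣≡2 {x = suc x} {suc y} x≢y = ∣⁅x⁆∪⁅y⁆∣≡2 (x≢y ∘ cong suc)

infix 4 _∈ᵛ_ _∉ᵛ_

_∈ᵛ_ : Fin n → KVertex n r → Set
x ∈ᵛ u = x ∈ proj₁ u

_∉ᵛ_ : Fin n → KVertex n r → Set
x ∉ᵛ u = x ∉ proj₁ u

private variable
  u w : KVertex n r

KVertex-≡ : proj₁ u ≡ proj₁ w → u ≡ w
KVertex-≡ {u = s , _} {w = .s , _} refl = cong (s ,_) (≡-irrelevant _ _)

-- Opaque: otherwise it unfolds in goals mentioning mapVertex below, and the proofs about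
-- mapVertex could no longer abstract over it with `with vertex-members u`.
opaque
  vertex-members : (u : KVertex n 2) → ∃₂ λ x y → x ≢ y × x ∈ᵛ u × y ∈ᵛ u
  vertex-members (_ , ∣p∣≡2) = 1<∣p∣⇒distinct-members (≤-reflexive (sym ∣p∣≡2))

member-of-vertex : (u : KVertex n 2) → x ≢ y → x ∈ᵛ u → y ∈ᵛ u → z ∈ᵛ u → z ≡ x ⊎ z ≡ y
member-of-vertex (_ , ∣p∣≡2) = ∣p∣≤2⇒z≡x⊎z≡y (≤-reflexive ∣p∣≡2)

other-member : (u : KVertex n 2) → x ∈ᵛ u → ∃ λ y → x ≢ y × y ∈ᵛ u
other-member {x = x} u x∈u with vertex-members u
... | a , b , a≢b , a∈u , b∈u with x ≟ a
...   | yes refl = b , a≢b , b∈u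
...   | no x≢a   = a , x≢a , a∈u

⊆-by-two-members : (u w : KVertex n 2) →
                   x ≢ y → x ∈ᵛ u → y ∈ᵛ u → x ∈ᵛ w → y ∈ᵛ w → proj₁ u ⊆ proj₁ w
⊆-by-two-members u w x≢y x∈u y∈u x∈w y∈w z∈u with member-of-vertex u x≢y x∈u y∈u z∈u
... | inj₁ refl = x∈w
... | inj₂ refl = y∈w

≡-by-two-members : (u w : KVertex n 2) → x ≢ y → x ∈ᵛ u → y ∈ᵛ u → x ∈ᵛ w → y ∈ᵛ w → u ≡ w
≡-by-two-members u w x≢y x∈u y∈u x∈w y∈w = KVertex-≡ (⊆-antisym
  (⊆-by-two-members u w x≢y x∈u y∈u x∈w y∈w)
  (⊆-by-two-members w u x≢y x∈w y∈w x∈u y∈u))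

pairVertex : {x y : Fin n} → x ≢ y → KVertex n 2
pairVertex {x = x} {y} x≢y = ⁅ x ⁆ ∪ ⁅ y ⁆ , ∣⁅x⁆∪⁅y⁆∣≡2 x≢y

∈-pairVertexˡ : (x≢y : x ≢ y) → x ∈ᵛ pairVertex x≢y
∈-pairVertexˡ {x = x} _ = x∈p∪q⁺ (inj₁ (x∈⁅x⁆ x))

∈-pairVertexʳ : (x≢y : x ≢ y) → y ∈ᵛ pairVertex x≢y
∈-pairVertexʳ {y = y} _ = x∈p∪q⁺ (inj₂ (x∈⁅x⁆ y))

⟨_,_⟩ : (x y : Fin n) {_ : False (x ≟ y)} → KVertex n 2
⟨ x , y ⟩ {x≢y} = pairVertex (toWitnessFalse x≢y)

KAdj⇒∉ : (u w : KVertex n r) → KAdj n r u w → x ∈ᵛ u → x ∉ᵛ w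
KAdj⇒∉ _ _ u~w x∈u x∈w = u~w (_ , x∈p∩q⁺ (x∈u , x∈w))

KAdj⇒≢ : (u w : KVertex n r) → KAdj n r u w → x ∈ᵛ u → y ∈ᵛ w → x ≢ y
KAdj⇒≢ u w u~w x∈u x∈w refl = KAdj⇒∉ u w u~w x∈u x∈w

∉⇒KAdj : (u w : KVertex n r) → (∀ {x} → x ∈ᵛ u → x ∉ᵛ w) → KAdj n r u w
∉⇒KAdj (p , _) (q , _) u∩w≡∅ (x , x∈p∩q) = Product.uncurry u∩w≡∅ (x∈p∩q⁻ p q x∈p∩q)

¬KAdj⇒common-member : (u w : KVertex n r) → ¬ KAdj n r u w → ∃ λ x → x ∈ᵛ u × x ∈ᵛ w
¬KAdj⇒common-member (p , _) (q , _) u≁w =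
  Product.map₂ (x∈p∩q⁻ p q) (decidable-stable (nonempty? (p ∩ q)) u≁w)

_≟ᵛ_ : DecidableEquality (KVertex n r)
u ≟ᵛ w = map′ KVertex-≡ (cong proj₁) (≡-dec _≟ᵇ_ (proj₁ u) (proj₁ w))

KAdj? : Decidable₂ (KAdj n r)
KAdj? (p , _) (q , _) = ¬? (nonempty? (p ∩ q))

PathAdj? : (k : ℕ) → Decidable₂ (PathAdj k)
PathAdj? k i j = (toℕ j ≟ℕ suc (toℕ i)) ⊎-dec (toℕ i ≟ℕ suc (toℕ j))

_⇔-dec_ : {A B : Set} → Dec A → Dec B → Dec (A ⇔ B)
a? ⇔-dec b? = map′ (Product.uncurry mk⇔) (λ a⇔b → Equivalence.to a⇔b , Equivalence.from a⇔b)
                   ((a? →-dec b?) ×-dec (b? →-dec a?))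

IsInducedPath : (V : Set) → (V → V → Set) → (k : ℕ) → (Fin k → V) → Set
IsInducedPath V E k f = Injective _≡_ _≡_ f × (∀ i j → E (f i) (f j) ⇔ PathAdj k i j)

module _ (_≟ⱽ_ : DecidableEquality V) where

  SamePair? : (u v x y : V) → Dec (SamePair u v x y)
  SamePair? u v x y = ((x ≟ⱽ u) ×-dec (y ≟ⱽ v)) ⊎-dec ((x ≟ⱽ v) ×-dec (y ≟ⱽ u))

  removeEdge? : Decidable₂ E → (u v : V) → Decidable₂ (removeEdge E u v)
  removeEdge? E? u v x y = E? x y ×-dec ¬? (SamePair? u v x y)

  addEdge? : Decidable₂ E → (u v : V) → Decidable₂ (addEdge E u v)
  addEdge? E? u v x y = E? x y ⊎-dec SamePair? u v x y

  isInducedPath? : Decidable₂ E → (f : Fin k → V) → Dec (IsInducedPath V E k f)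
  isInducedPath? {k = k} E? f =
    injective? ×-dec all? λ i → all? λ j → E? (f i) (f j) ⇔-dec PathAdj? k i j
    where
    injective? : Dec (Injective _≡_ _≡_ f)
    injective? = map′ (λ inj {i} {j} → inj i j) (λ inj i j → inj)
                      (all? λ i → all? λ j → (f i ≟ⱽ f j) →-dec (i ≟ j))

-- The point of w in c lies outside a and b, so the other point of w lies in both.
meets-P₃⇒meets-ends : (w a c b : KVertex n 2) →
  ¬ KAdj n 2 w a → ¬ KAdj n 2 w c → ¬ KAdj n 2 w b → KAdj n 2 c a → KAdj n 2 c b →
  ∃ λ x → x ∈ᵛ w × x ∈ᵛ a × x ∈ᵛ b
meets-P₃⇒meets-ends w a c b w≁a w≁c w≁b c~a c~b
  with ¬KAdj⇒common-member w c w≁c | ¬KAdj⇒common-member w a w≁a | ¬KAdj⇒common-member w b w≁b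
... | x , x∈w , x∈c | y , y∈w , y∈a | z , z∈w , z∈b
  with member-of-vertex w (KAdj⇒≢ c a c~a x∈c y∈a) x∈w y∈w z∈w
...   | inj₁ refl = ⊥-elim (KAdj⇒∉ c b c~b x∈c z∈b)
...   | inj₂ refl = y , y∈w , y∈a , z∈b

KAdj-no-induced-P₆ : ¬ InducedPath (KVertex n 2) (KAdj n 2) 6
KAdj-no-induced-P₆ {n} (v , v-inj , v-path) = contradiction (v-inj v₃≡v₅) λ ()
  where
  adj : ∀ i j {_ : True (PathAdj? 6 i j)} → KAdj n 2 (v i) (v j)
  adj i j {i~j} = Equivalence.from (v-path i j) (toWitness i~j)

  nonadj : ∀ i j {_ : False (PathAdj? 6 i j)} → ¬ KAdj n 2 (v i) (v j)
  nonadj i j {i≁j} = toWitnessFalse i≁j ∘ Equivalence.to (v-path i j)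

  meets-v₃∩v₅ : ∀ i {_ : False (PathAdj? 6 i (# 3))} {_ : False (PathAdj? 6 i (# 4))}
                  {_ : False (PathAdj? 6 i (# 5))} →
                ∃ λ x → x ∈ᵛ v i × x ∈ᵛ v (# 3) × x ∈ᵛ v (# 5)
  meets-v₃∩v₅ i {i≁3} {i≁4} {i≁5} =
    meets-P₃⇒meets-ends (v i) (v (# 3)) (v (# 4)) (v (# 5))
      (nonadj i (# 3) {i≁3}) (nonadj i (# 4) {i≁4}) (nonadj i (# 5) {i≁5})
      (adj (# 4) (# 3)) (adj (# 4) (# 5))

  v₃≡v₅ : v (# 3) ≡ v (# 5)
  v₃≡v₅ with meets-v₃∩v₅ (# 0) | meets-v₃∩v₅ (# 1)
  ... | x , x∈v₀ , x∈v₃ , x∈v₅ | y , y∈v₁ , y∈v₃ , y∈v₅ =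
    ≡-by-two-members (v (# 3)) (v (# 5)) (KAdj⇒≢ (v (# 0)) (v (# 1)) (adj (# 0) (# 1)) x∈v₀ y∈v₁)
      x∈v₃ y∈v₃ x∈v₅ y∈v₅

InducedPath-map : (φ : V → W) → Injective _≡_ _≡_ φ → (∀ x y → E x y ⇔ F (φ x) (φ y)) →
                  InducedPath V E k → InducedPath W F k
InducedPath-map φ φ-inj φ-adj (f , f-inj , f-path) =
  φ ∘ f , f-inj ∘ φ-inj , λ i j → f-path i j ⇔-∘ ⇔-sym (φ-adj (f i) (f j))

module _ (φ : V → W) (φ-inj : Injective _≡_ _≡_ φ) where

  SamePair-map : {u v x y : V} → SamePair u v x y ⇔ SamePair (φ u) (φ v) (φ x) (φ y)
  SamePair-map = mk⇔ (Sum.map (Product.map (cong φ) (cong φ)) (Product.map (cong φ) (cong φ)))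
                     (Sum.map (Product.map φ-inj φ-inj) (Product.map φ-inj φ-inj))

  module _ (φ-adj : ∀ x y → E x y ⇔ F (φ x) (φ y)) {u v : V} where

    removeEdge-InducedPath-map :
      InducedPath V (removeEdge E u v) k → InducedPath W (removeEdge F (φ u) (φ v)) k
    removeEdge-InducedPath-map =
      InducedPath-map {E = removeEdge E u v} {F = removeEdge F (φ u) (φ v)} φ φ-inj
        λ x y → φ-adj x y ×-⇔ ¬-cong-⇔ SamePair-map

    addEdge-InducedPath-map :
      InducedPath V (addEdge E u v) k → InducedPath W (addEdge F (φ u) (φ v)) k
    addEdge-InducedPath-map =
      InducedPath-map {E = addEdge E u v} {F = addEdge F (φ u) (φ v)} φ φ-inj
        λ x y → φ-adj x y ⊎-⇔ SamePair-map

module _ {m n} (g : Fin m → Fin n) (g-inj : Injective _≡_ _≡_ g) where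

  mapVertex : KVertex m 2 → KVertex n 2
  mapVertex u with vertex-members u
  ... | x , y , x≢y , _ = pairVertex (x≢y ∘ g-inj)

  ∈-mapVertex⁺ : (u : KVertex m 2) → x ∈ᵛ u → g x ∈ᵛ mapVertex u
  ∈-mapVertex⁺ u z∈u with vertex-members u
  ... | x , y , x≢y , x∈u , y∈u with member-of-vertex u x≢y x∈u y∈u z∈u
  ...   | inj₁ refl = ∈-pairVertexˡ (x≢y ∘ g-inj)
  ...   | inj₂ refl = ∈-pairVertexʳ (x≢y ∘ g-inj)

  ∈-mapVertex⁻ : (u : KVertex m 2) → z ∈ᵛ mapVertex u → ∃ λ x → x ∈ᵛ u × g x ≡ z
  ∈-mapVertex⁻ u z∈u′ with vertex-members u
  ... | x , y , x≢y , x∈u , y∈u with x∈p∪q⁻ ⁅ g x ⁆ ⁅ g y ⁆ z∈u′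
  ...   | inj₁ z∈⁅gx⁆ = x , x∈u , sym (x∈⁅y⁆⇒x≡y (g x) z∈⁅gx⁆)
  ...   | inj₂ z∈⁅gy⁆ = y , y∈u , sym (x∈⁅y⁆⇒x≡y (g y) z∈⁅gy⁆)

  mapVertex-reflects-⊆ : (u w : KVertex m 2) →
                         proj₁ (mapVertex u) ⊆ proj₁ (mapVertex w) → proj₁ u ⊆ proj₁ w
  mapVertex-reflects-⊆ u w u′⊆w′ x∈u with ∈-mapVertex⁻ w (u′⊆w′ (∈-mapVertex⁺ u x∈u))
  ... | y , y∈w , gy≡gx = subst (_∈ᵛ w) (g-inj gy≡gx) y∈w

  mapVertex-injective : Injective _≡_ _≡_ mapVertex
  mapVertex-injective {u} {w} u′≡w′ = KVertex-≡ (⊆-antisym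
    (mapVertex-reflects-⊆ u w (⊆-reflexive (cong proj₁ u′≡w′)))
    (mapVertex-reflects-⊆ w u (⊆-reflexive (cong proj₁ (sym u′≡w′)))))

  KAdj-mapVertex : (u w : KVertex m 2) → KAdj m 2 u w ⇔ KAdj n 2 (mapVertex u) (mapVertex w)
  KAdj-mapVertex u w = mk⇔ preserve reflect
    where
    preserve : KAdj m 2 u w → KAdj n 2 (mapVertex u) (mapVertex w)
    preserve u~w = ∉⇒KAdj (mapVertex u) (mapVertex w) λ z∈u′ z∈w′ →
      disjoint-preimages (∈-mapVertex⁻ u z∈u′) (∈-mapVertex⁻ w z∈w′)
      where
      disjoint-preimages : (∃ λ x → x ∈ᵛ u × g x ≡ z) → (∃ λ y → y ∈ᵛ w × g y ≡ z) → ⊥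
      disjoint-preimages (x , x∈u , refl) (y , y∈w , gy≡gx) =
        KAdj⇒≢ u w u~w x∈u y∈w (sym (g-inj gy≡gx))
    reflect : KAdj n 2 (mapVertex u) (mapVertex w) → KAdj m 2 u w
    reflect u′~w′ = ∉⇒KAdj u w λ x∈u x∈w →
      KAdj⇒∉ (mapVertex u) (mapVertex w) u′~w′ (∈-mapVertex⁺ u x∈u) (∈-mapVertex⁺ w x∈w)

  mapVertex-⟨⟩ : (x y : Fin m) {x≢y : False (x ≟ y)} (u : KVertex n 2) →
                 g x ∈ᵛ u → g y ∈ᵛ u → mapVertex (⟨ x , y ⟩ {x≢y}) ≡ u
  mapVertex-⟨⟩ x y {x≢y} u gx∈u gy∈u =
    ≡-by-two-members _ u (toWitnessFalse x≢y ∘ g-inj)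
      (∈-mapVertex⁺ _ (∈-pairVertexˡ (toWitnessFalse x≢y)))
      (∈-mapVertex⁺ _ (∈-pairVertexʳ (toWitnessFalse x≢y)))
      gx∈u gy∈u

-- If every point had a preimage under h, choosing preimages would inject Fin n into Fin k.
fresh-point : k < n → (h : Fin k → Fin n) → ∃ λ e → ∀ i → e ≢ h i
fresh-point {k} {n} k<n h with any? (λ e → all? λ i → ¬? (e ≟ h i))
... | yes fresh = fresh
... | no ¬fresh = contradiction (injective⇒≤ preimage-injective) (<⇒≱ k<n)
  where
  preimage : ∀ e → ∃ λ i → e ≡ h i
  preimage e = Product.map₂ (decidable-stable (e ≟ h _))
                 (¬∀⟶∃¬ k _ (λ i → ¬? (e ≟ h i)) (λ e∉h → ¬fresh (e , e∉h)))
  preimage-injective : Injective _≡_ _≡_ (proj₁ ∘ preimage)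
  preimage-injective {e} {e′} i≡i′ =
    trans (proj₂ (preimage e)) (trans (cong h i≡i′) (sym (proj₂ (preimage e′))))

[]-injective : {A : Set} → Injective _≡_ _≡_ ([] {A = A})
[]-injective {x = ()}

injective-∷ : {h : Fin k → Fin n} → (∀ i → e ≢ h i) → Injective _≡_ _≡_ h →
              Injective _≡_ _≡_ (e ∷ h)
injective-∷ e∉h h-inj {zero}  {zero}  _     = refl
injective-∷ e∉h h-inj {zero}  {suc j} e≡hj  = contradiction e≡hj (e∉h j)
injective-∷ e∉h h-inj {suc i} {zero}  hi≡e  = contradiction (sym hi≡e) (e∉h i)
injective-∷ e∉h h-inj {suc i} {suc j} hi≡hj = cong suc (h-inj hi≡hj)

extend-injection : k < n → (h : Fin k → Fin n) → Injective _≡_ _≡_ h →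
                   ∃ λ e → Injective _≡_ _≡_ (e ∷ h)
extend-injection k<n h h-inj = Product.map₂ (λ e∉h → injective-∷ e∉h h-inj) (fresh-point k<n h)

K₅₂-removeEdge-P₆ : InducedPath (KVertex 5 2) (removeEdge (KAdj 5 2) ⟨ # 1 , # 2 ⟩ ⟨ # 3 , # 4 ⟩) 6
K₅₂-removeEdge-P₆ =
  path , from-yes (isInducedPath? _≟ᵛ_ (removeEdge? _≟ᵛ_ KAdj? ⟨ # 1 , # 2 ⟩ ⟨ # 3 , # 4 ⟩) path)
  where
  path : Fin 6 → KVertex 5 2
  path = ⟨ # 1 , # 2 ⟩ ∷ ⟨ # 0 , # 3 ⟩ ∷ ⟨ # 1 , # 4 ⟩ ∷ ⟨ # 2 , # 3 ⟩ ∷ ⟨ # 0 , # 1 ⟩ ∷ ⟨ # 3 , # 4 ⟩ ∷ []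

K₅₂-addEdge-P₆ : InducedPath (KVertex 5 2) (addEdge (KAdj 5 2) ⟨ # 2 , # 3 ⟩ ⟨ # 2 , # 4 ⟩) 6
K₅₂-addEdge-P₆ =
  path , from-yes (isInducedPath? _≟ᵛ_ (addEdge? _≟ᵛ_ KAdj? ⟨ # 2 , # 3 ⟩ ⟨ # 2 , # 4 ⟩) path)
  where
  path : Fin 6 → KVertex 5 2
  path = ⟨ # 2 , # 3 ⟩ ∷ ⟨ # 2 , # 4 ⟩ ∷ ⟨ # 0 , # 3 ⟩ ∷ ⟨ # 1 , # 2 ⟩ ∷ ⟨ # 3 , # 4 ⟩ ∷ ⟨ # 0 , # 2 ⟩ ∷ []

Labelling : (u v : KVertex n 2) → KVertex 5 2 → KVertex 5 2 → Set
Labelling {n} u v u₀ v₀ = Σ (Fin 5 → Fin n) λ g → Σ (Injective _≡_ _≡_ g) λ g-inj →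
  mapVertex g g-inj u₀ ≡ u × mapVertex g g-inj v₀ ≡ v

edge-labelling : 5 ≤ n → (u v : KVertex n 2) → KAdj n 2 u v →
                 Labelling u v ⟨ # 1 , # 2 ⟩ ⟨ # 3 , # 4 ⟩
edge-labelling 5≤n u v u~v with vertex-members u | vertex-members v
... | a , b , a≢b , a∈u , b∈u | c , d , c≢d , c∈v , d∈v
  with extend-injection 5≤n (a ∷ b ∷ c ∷ d ∷ [])
         (injective-∷ (λ { zero             → a≢b
                         ; (suc zero)       → KAdj⇒≢ u v u~v a∈u c∈v
                         ; (suc (suc zero)) → KAdj⇒≢ u v u~v a∈u d∈v })
         (injective-∷ (λ { zero       → KAdj⇒≢ u v u~v b∈u c∈v
                         ; (suc zero) → KAdj⇒≢ u v u~v b∈u d∈v })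
         (injective-∷ (λ { zero → c≢d })
         (injective-∷ (λ ()) []-injective))))
... | _ , g-inj =
  _ , g-inj , mapVertex-⟨⟩ _ g-inj (# 1) (# 2) u a∈u b∈u , mapVertex-⟨⟩ _ g-inj (# 3) (# 4) v c∈v d∈v

nonedge-labelling : 5 ≤ n → (u v : KVertex n 2) → u ≢ v → ¬ KAdj n 2 u v →
                    Labelling u v ⟨ # 2 , # 3 ⟩ ⟨ # 2 , # 4 ⟩
nonedge-labelling 5≤n u v u≢v u≁v with ¬KAdj⇒common-member u v u≁v
... | x , x∈u , x∈v with other-member u x∈u | other-member v x∈v
... | y , x≢y , y∈u | z , x≢z , z∈v
  with extend-injection (≤-trans (n≤1+n 4) 5≤n) (x ∷ y ∷ z ∷ [])
         (injective-∷ (λ { zero → x≢y ; (suc zero) → x≢z })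
         (injective-∷ (λ { zero refl → u≢v (≡-by-two-members u v x≢y x∈u y∈u x∈v z∈v) })
         (injective-∷ (λ ()) []-injective)))
... | w , wxyz-inj with extend-injection 5≤n (w ∷ x ∷ y ∷ z ∷ []) wxyz-inj
... | _ , g-inj =
  _ , g-inj , mapVertex-⟨⟩ _ g-inj (# 2) (# 3) u x∈u y∈u , mapVertex-⟨⟩ _ g-inj (# 2) (# 4) v x∈v z∈v

Labelling-removeEdge-P₆ : {u₀ v₀ : KVertex 5 2} {u v : KVertex n 2} → Labelling u v u₀ v₀ →
                          InducedPath (KVertex 5 2) (removeEdge (KAdj 5 2) u₀ v₀) 6 →
                          InducedPath (KVertex n 2) (removeEdge (KAdj n 2) u v) 6
Labelling-removeEdge-P₆ {n} (g , g-inj , refl , refl) =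
  removeEdge-InducedPath-map (mapVertex g g-inj) (mapVertex-injective g g-inj)
    {E = KAdj 5 2} {F = KAdj n 2} (KAdj-mapVertex g g-inj)

Labelling-addEdge-P₆ : {u₀ v₀ : KVertex 5 2} {u v : KVertex n 2} → Labelling u v u₀ v₀ →
                       InducedPath (KVertex 5 2) (addEdge (KAdj 5 2) u₀ v₀) 6 →
                       InducedPath (KVertex n 2) (addEdge (KAdj n 2) u v) 6
Labelling-addEdge-P₆ {n} (g , g-inj , refl , refl) =
  addEdge-InducedPath-map (mapVertex g g-inj) (mapVertex-injective g g-inj)
    {E = KAdj 5 2} {F = KAdj n 2} (KAdj-mapVertex g g-inj)

theorem1p4 : (n : ℕ) → 5 ≤ n → InducedSaturated (KVertex n 2) (KAdj n 2) 6
theorem1p4 n 5≤n =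
  KAdj-no-induced-P₆ ,
  (λ u v u~v → Labelling-removeEdge-P₆ (edge-labelling 5≤n u v u~v) K₅₂-removeEdge-P₆) ,
  (λ u v u≢v u≁v → Labelling-addEdge-P₆ (nonedge-labelling 5≤n u v u≢v u≁v) K₅₂-addEdge-P₆)
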